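{- Let $R$ be a relation that is a delta matroid and lies in IM-conj. Then $R$ is basically binary.
   Context: A relation on a finite set $V$ is a subset $R\subseteq\{0,1\}^V$. IM-conj is the class of relations that are conjunctions of constraints of the forms $x_i\le x_j$ and $x_i=c$ ($c\in\{0,1\}$). $R$ is a delta matroid if for all $x,y\in R$ and every $i$ with $x_i\ne y_i$ there is $j$ (possibly $j=i$) with $x_j\ne y_j$ such that the configuration obtained from $x$ by flipping the coordinates in $\{i,j\}$ lies in $R$. $R$ is basically binary if, up to renaming variables, it is a Cartesian product of relations of arity at most two. -}

module Defs where

open import Data.Nat using (ℕ; _≤_)
open import Data.Bool using (Bool; not) renaming (_≤_ to _≤ᵇ_)
open import Data.Fin using (Fin; _≟_)
open import Data.Vec using (Vec; lookup; updateAt; map; toList)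
open import Data.List using (List; []; _∷_; _++_; concatMap)
open import Data.List.Relation.Unary.All using (All)
open import Data.List.Relation.Unary.Unique.Propositional using (Unique)
open import Data.List.Membership.Propositional using (_∈_)
open import Data.Product using (Σ; ∃; _×_; _,_)
open import Relation.Nullary using (¬_; yes; no)
open import Relation.Binary.PropositionalEquality using (_≡_; _≢_)
open import Function.Bundles using (_⇔_)

-- A configuration on V = Fin n is an assignment V → {0,1} (0 = false, 1 = true),
-- represented as a vector; a relation on V is a predicate on configurations.
Config : ℕ → Set
Config n = Vec Bool n

Relation : ℕ → Set₁
Relation n = Config n → Set

flip1 : ∀ {n} → Config n → Fin n → Config n
flip1 x i = updateAt x i not

flip2 : ∀ {n} → Config n → Fin n → Fin n → Config n
flip2 x i j with i ≟ j
... | yes _ = flip1 x i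
... | no  _ = flip1 (flip1 x i) j

DeltaMatroid : ∀ {n} → Relation n → Set
DeltaMatroid {n} R =
  ∀ (x y : Config n) → R x → R y →
  ∀ (i : Fin n) → lookup x i ≢ lookup y i →
  ∃ λ (j : Fin n) → lookup x j ≢ lookup y j × R (flip2 x i j)

data Constraint (n : ℕ) : Set where
  leq : Fin n → Fin n → Constraint n
  eqc : Fin n → Bool → Constraint n

Sat : ∀ {n} → Config n → Constraint n → Set
Sat x (leq i j) = lookup x i ≤ᵇ lookup x j
Sat x (eqc i c) = lookup x i ≡ c

InIMConj : ∀ {n} → Relation n → Set
InIMConj {n} R = Σ (List (Constraint n)) λ cs → ∀ (x : Config n) → R x ⇔ All (Sat x) cs

record Factor (n : ℕ) : Set₁ where
  field
    arity   : ℕ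
    arity≤2 : arity ≤ 2
    vars    : Vec (Fin n) arity
    rel     : Vec Bool arity → Set

open Factor public

factorVars : ∀ {n} → List (Factor n) → List (Fin n)
factorVars = concatMap (λ f → toList (vars f))

FactorHolds : ∀ {n} → Config n → Factor n → Set
FactorHolds x f = rel f (map (lookup x) (vars f))

-- R is basically binary: up to renaming of variables it is a Cartesian product of
-- relations of arity at most two, i.e. the variables are partitioned (each variable
-- occurs exactly once) among factors of arity ≤ 2 and R is the product of the factors.
BasicallyBinary : ∀ {n} → Relation n → Set₁
BasicallyBinary {n} R =
  Σ (List (Factor n)) λ fs →
    Unique (factorVars fs) ×
    (∀ (i : Fin n) → i ∈ factorVars fs) ×
    (∀ (x : Config n) → R x ⇔ All (FactorHolds x) fs)

-- Call an implication u ⇒ v (every member of R with u = 1 has v = 1) an edge of R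
-- when it is not trivial: u ≠ v, u can be 1 and v can be 0.  The proof has three
-- independent parts, combined at the end.
--
--  * IM-conj relations are closed under pointwise ∧ and ∨, and an IM-conj relation
--    is glued from local data: it contains every configuration x that agrees with
--    some member of R on each single variable and on both ends of each edge.
--  * In a delta matroid closed under ∧ and ∨ the edges, taken without orientation,
--    form a matching: a delta-matroid exchange step changes its pivot and at most
--    one further coordinate, which forbids two edges sharing an endpoint.
--  * A matching splits the variables into blocks of size ≤ 2 (the matched pairs and
--    the unmatched singletons), and a relation that is glued from its projections
--    onto such a partition is the product of those projections, hence basically
--    binary.
module Submission where

open import Defs
open import Data.Nat using (ℕ; zero; suc; z≤n; s≤s) renaming (_≤_ to _≤ⁿ_)
open import Data.Nat.Properties using (≤-refl)
open import Data.Bool using (Bool; true; false; not; _∧_; _∨_; b≤b) renaming (_≤_ to _≤ᵇ_)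
open import Data.Bool.Properties
  using (≤-minimum; ≤-maximum; ∧-idem; ∨-idem; ∧-zeroʳ; ∨-zeroʳ; not-¬; ¬-not)
  renaming (_≟_ to _≟ᵇ_; _≤?_ to _≤ᵇ?_)
open import Data.Fin using (Fin; _<_) renaming (_≟_ to _≟ᶠ_)
open import Data.Fin.Properties using (any?; _<?_; <-cmp; <-irrefl; <-asym)
open import Data.Vec using (Vec; []; _∷_; lookup; zipWith; toList; map)
open import Data.Vec.Properties using (lookup∘updateAt; lookup∘updateAt′; lookup-zipWith; ∷-injective)
open import Data.List using (List; allFin; concat; concatMap)
import Data.List as List
open import Data.List.Properties using (map-∘)
open import Data.List.Relation.Unary.All as All using (All; []; _∷_)
import Data.List.Relation.Unary.All.Properties as All
open import Data.List.Relation.Unary.Any using (here; there)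
open import Data.List.Relation.Unary.AllPairs as AllPairs using ([]; _∷_)
import Data.List.Relation.Unary.AllPairs.Properties as AllPairs
open import Data.List.Relation.Unary.Unique.Propositional using (Unique)
open import Data.List.Relation.Unary.Unique.Propositional.Properties using (concat⁺; allFin⁺)
open import Data.List.Relation.Binary.Disjoint.Propositional using (Disjoint)
open import Data.List.Membership.Propositional using (_∈_)
open import Data.List.Membership.Propositional.Properties using (∈-map⁺; ∈-concat⁺′; ∈-allFin)
open import Data.Product using (Σ; ∃; _×_; _,_; proj₁; proj₂)
open import Data.Sum using (_⊎_; inj₁; inj₂)
open import Data.Empty using (⊥; ⊥-elim)
open import Function.Base using (_∘_)
open import Function.Bundles using (mk⇔; Equivalence)
open import Relation.Nullary using (¬_; Dec; yes; no)
open import Relation.Nullary.Decidable using (map′; _×-dec_; _⊎-dec_; ¬?)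
open import Relation.Binary.Definitions using (tri<; tri≈; tri>)
open import Relation.Binary.PropositionalEquality
  using (_≡_; _≢_; refl; sym; trans; cong; subst; ≢-sym)

private
  variable
    n : ℕ

both-values : ∀ {b} → b ≡ true → b ≡ false → ⊥
both-values refl ()

differ : ∀ {p q c} → p ≡ c → q ≡ not c → q ≢ p
differ p≡c q≡¬c q≡p = not-¬ p≡c (trans (sym q≡p) q≡¬c)

Monotone₂ : (Bool → Bool → Bool) → Set
Monotone₂ f = ∀ {a b c d} → a ≤ᵇ c → b ≤ᵇ d → f a b ≤ᵇ f c d

∧-monotone : Monotone₂ _∧_
∧-monotone {false} _   _ = ≤-minimum _
∧-monotone {true}  b≤b q = q

∨-monotone : Monotone₂ _∨_
∨-monotone {true}              b≤b _ = b≤b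
∨-monotone {false} {c = true}  _   _ = ≤-maximum _
∨-monotone {false} {c = false} _   q = q

any-config? : ∀ n {P : Config n → Set} → (∀ x → Dec (P x)) → Dec (∃ P)
any-config? zero    P? = map′ ([] ,_) (λ { ([] , p) → p }) (P? [])
any-config? (suc n) P? =
  map′ (λ { (inj₁ (v , p)) → true ∷ v , p ; (inj₂ (v , p)) → false ∷ v , p })
       (λ { (true ∷ v , p) → inj₁ (v , p) ; (false ∷ v , p) → inj₂ (v , p) })
       (any-config? n (P? ∘ (true ∷_)) ⊎-dec any-config? n (P? ∘ (false ∷_)))

flip2-pivot : ∀ (x : Config n) i j → lookup (flip2 x i j) i ≡ not (lookup x i)
flip2-pivot x i j with i ≟ᶠ j
... | yes _  = lookup∘updateAt i x
... | no i≢j = trans (lookup∘updateAt′ i j i≢j (flip1 x i)) (lookup∘updateAt i x)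

flip2-changes : ∀ (x : Config n) i j m → lookup (flip2 x i j) m ≢ lookup x m → m ≡ i ⊎ m ≡ j
flip2-changes x i j m changed with m ≟ᶠ i | m ≟ᶠ j
... | yes m≡i | _       = inj₁ m≡i
... | no _    | yes m≡j = inj₂ m≡j
... | no m≢i  | no m≢j with i ≟ᶠ j
...   | yes _ = ⊥-elim (changed (lookup∘updateAt′ m i m≢i x))
...   | no _  = ⊥-elim (changed (trans (lookup∘updateAt′ m j m≢j (flip1 x i))
                                        (lookup∘updateAt′ m i m≢i x)))

record ExchangeStep (R : Relation n) (a y : Config n) (i : Fin n) : Set where
  field
    result    : Config n
    member    : R result
    pivot     : lookup result i ≡ lookup y i
    one-other : ∀ {m m'} → m ≢ i → m' ≢ i →
                lookup result m ≢ lookup a m → lookup result m' ≢ lookup a m' → m ≡ m'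

exchange : {R : Relation n} → DeltaMatroid R → ∀ {a y i} → R a → R y →
           lookup a i ≢ lookup y i → ExchangeStep R a y i
exchange dm {a} {y} {i} ra ry a≢y with dm a y ra ry i a≢y
... | j , _ , rb = record
  { result    = flip2 a i j
  ; member    = rb
  ; pivot     = trans (flip2-pivot a i j) (sym (¬-not (≢-sym a≢y)))
  ; one-other = λ m≢i m'≢i cm cm' → trans (only-j m≢i cm) (sym (only-j m'≢i cm'))
  }
  where
  only-j : ∀ {m} → m ≢ i → lookup (flip2 a i j) m ≢ lookup a m → m ≡ j
  only-j {m} m≢i cm with flip2-changes a i j m cm
  ... | inj₁ m≡i = ⊥-elim (m≢i m≡i)
  ... | inj₂ m≡j = m≡j

zipWith-sat : ∀ f → Monotone₂ f → (∀ b → f b b ≡ b) →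
              ∀ {x z : Config n} c → Sat x c → Sat z c → Sat (zipWith f x z) c
zipWith-sat f mono idem {x} {z} (leq i j) s t
  rewrite lookup-zipWith f i x z | lookup-zipWith f j x z = mono s t
zipWith-sat f mono idem {x} {z} (eqc i b) s t
  rewrite lookup-zipWith f i x z | s | t = idem b

conj-closed : ∀ {R : Relation n} → InIMConj R → ∀ f → Monotone₂ f → (∀ b → f b b ≡ b) →
              ∀ {x z} → R x → R z → R (zipWith f x z)
conj-closed {R = R} (cs , R⇔cs) f mono idem {x} {z} rx rz =
  Equivalence.from (R⇔cs _) (All.tabulate λ {c} c∈cs →
    zipWith-sat f mono idem c (satisfies rx c∈cs) (satisfies rz c∈cs))
  where
  satisfies : ∀ {w c} → R w → c ∈ cs → Sat w c
  satisfies rw = All.lookup (Equivalence.to (R⇔cs _) rw)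

conj-decidable : ∀ {R : Relation n} → InIMConj R → ∀ x → Dec (R x)
conj-decidable (cs , R⇔cs) x =
  map′ (Equivalence.from (R⇔cs x)) (Equivalence.to (R⇔cs x)) (All.all? sat? cs)
  where
  sat? : ∀ c → Dec (Sat x c)
  sat? (leq i j) = lookup x i ≤ᵇ? lookup x j
  sat? (eqc i b) = lookup x i ≟ᵇ b

module ImplicationGraph {n : ℕ} (R : Relation n) where

  Implies : Fin n → Fin n → Set
  Implies u v = ∀ {y} → R y → lookup y u ≡ true → lookup y v ≡ true

  implies-back : ∀ {u v y} → Implies u v → R y → lookup y v ≡ false → lookup y u ≡ false
  implies-back u⇒v ry yv = ¬-not (λ yu → both-values (u⇒v ry yu) yv)

  Attains : Fin n → Bool → Set
  Attains u c = ∃ λ y → R y × lookup y u ≡ c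

  Edge : Fin n → Fin n → Set
  Edge u v = u ≢ v × Implies u v × Attains u true × Attains v false

  Adj : Fin n → Fin n → Set
  Adj u v = Edge u v ⊎ Edge v u

  Adj-sym : ∀ {u v} → Adj u v → Adj v u
  Adj-sym (inj₁ e) = inj₂ e
  Adj-sym (inj₂ e) = inj₁ e

  Adj-irrefl : ∀ {u v} → Adj u v → u ≢ v
  Adj-irrefl (inj₁ (u≢v , _)) = u≢v
  Adj-irrefl (inj₂ (v≢u , _)) = ≢-sym v≢u

  module Decidability (R? : ∀ x → Dec (R x)) where

    Implies? : ∀ u v → Dec (Implies u v)
    Implies? u v =
      map′ (λ no-cex {y} ry yu → ¬-not (λ yv → no-cex (y , ry , yu , yv)))
           (λ u⇒v (y , ry , yu , yv) → both-values (u⇒v ry yu) yv)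
           (¬? (any-config? n λ y → R? y ×-dec (lookup y u ≟ᵇ true ×-dec lookup y v ≟ᵇ false)))

    Attains? : ∀ u c → Dec (Attains u c)
    Attains? u c = any-config? n λ y → R? y ×-dec (lookup y u ≟ᵇ c)

    Adj? : ∀ u v → Dec (Adj u v)
    Adj? u v = Edge? u v ⊎-dec Edge? v u
      where
      Edge? : ∀ u v → Dec (Edge u v)
      Edge? u v = ¬? (u ≟ᶠ v) ×-dec (Implies? u v ×-dec (Attains? u true ×-dec Attains? v false))

  module Matching (dm : DeltaMatroid R)
                  (∧-closed : ∀ {x z} → R x → R z → R (zipWith _∧_ x z))
                  (∨-closed : ∀ {x z} → R x → R z → R (zipWith _∨_ x z)) where

    -- Two edges leaving i: exchange from x ∧ z (all of i, j, k are 0) towards a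
    -- member with i = 1 forces both j and k to change.
    out-out : ∀ {i j k} → Edge i j → Edge i k → j ≡ k
    out-out {i} {j} {k} (i≢j , i⇒j , (y , ry , yi) , (x , rx , xj)) (i≢k , i⇒k , _ , (z , rz , zk)) =
      one-other (≢-sym i≢j) (≢-sym i≢k) (differ aj (i⇒j member bi)) (differ ak (i⇒k member bi))
      where
      a = zipWith _∧_ x z
      aj : lookup a j ≡ false
      aj = trans (lookup-zipWith _∧_ j x z) (cong (_∧ lookup z j) xj)
      ak : lookup a k ≡ false
      ak = trans (lookup-zipWith _∧_ k x z) (trans (cong (lookup x k ∧_) zk) (∧-zeroʳ _))
      ai : lookup a i ≡ false
      ai = implies-back i⇒j (∧-closed rx rz) aj
      open ExchangeStep (exchange dm (∧-closed rx rz) ry (differ yi ai))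
      bi : lookup result i ≡ true
      bi = trans pivot yi

    -- Two edges entering i: dual, exchanging from y ∨ z towards a member with i = 0.
    in-in : ∀ {i j k} → Edge j i → Edge k i → j ≡ k
    in-in {i} {j} {k} (j≢i , j⇒i , (y , ry , yj) , (x , rx , xi)) (k≢i , k⇒i , (z , rz , zk) , _) =
      one-other j≢i k≢i (differ aj (implies-back j⇒i member bi))
                        (differ ak (implies-back k⇒i member bi))
      where
      a = zipWith _∨_ y z
      aj : lookup a j ≡ true
      aj = trans (lookup-zipWith _∨_ j y z) (cong (_∨ lookup z j) yj)
      ak : lookup a k ≡ true
      ak = trans (lookup-zipWith _∨_ k y z) (trans (cong (lookup y k ∨_) zk) (∨-zeroʳ _))
      ai : lookup a i ≡ true
      ai = j⇒i (∨-closed ry rz) aj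
      open ExchangeStep (exchange dm (∨-closed ry rz) rx (differ xi ai))
      bi : lookup result i ≡ false
      bi = trans pivot xi

    -- A path k → i → j closes up: otherwise exchange from a member with j = 0
    -- (hence i = k = 0) towards one with k = 1 would change both i and j.
    chain : ∀ {i j k} → Edge i j → Edge k i → j ≡ k
    chain {j = j} {k = k} _ _ with j ≟ᶠ k
    chain _ _ | yes j≡k = j≡k
    chain {i} {j} {k} (i≢j , i⇒j , _ , (x , rx , xj)) (k≢i , k⇒i , (y , ry , yk) , _) | no j≢k =
      ⊥-elim (i≢j (one-other (≢-sym k≢i) j≢k (differ xi bi) (differ xj (i⇒j member bi))))
      where
      xi : lookup x i ≡ false
      xi = implies-back i⇒j rx xj
      xk : lookup x k ≡ false
      xk = implies-back k⇒i rx xi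
      open ExchangeStep (exchange dm rx ry (differ yk xk))
      bi : lookup result i ≡ true
      bi = k⇒i member (trans pivot yk)

    Adj-unique : ∀ {i j k} → Adj i j → Adj i k → j ≡ k
    Adj-unique (inj₁ e) (inj₁ f) = out-out e f
    Adj-unique (inj₂ e) (inj₂ f) = in-in e f
    Adj-unique (inj₁ e) (inj₂ f) = chain e f
    Adj-unique (inj₂ e) (inj₁ f) = sym (chain f e)

conj-glue : ∀ {R : Relation n} → InIMConj R → ∀ x →
            (∀ e → ∃ λ y → R y × lookup y e ≡ lookup x e) →
            (∀ {u v} → ImplicationGraph.Edge R u v →
               ∃ λ y → R y × lookup y u ≡ lookup x u × lookup y v ≡ lookup x v) →
            R x
conj-glue {R = R} (cs , R⇔cs) x local edge-local =
  Equivalence.from (R⇔cs x) (All.tabulate λ {c} → sat c)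
  where
  open ImplicationGraph R
  satisfies : ∀ {w c} → R w → c ∈ cs → Sat w c
  satisfies rw = All.lookup (Equivalence.to (R⇔cs _) rw)

  leq-implies : ∀ {u v} → leq u v ∈ cs → Implies u v
  leq-implies {v = v} c∈cs {y} ry yu = true≤ (subst (_≤ᵇ lookup y v) yu (satisfies ry c∈cs))
    where
    true≤ : ∀ {b} → true ≤ᵇ b → b ≡ true
    true≤ b≤b = refl

  -- A constraint u ≤ v could only fail with x_u = 1 and x_v = 0; then u ⇒ v is an
  -- edge, and the member of R realising x on {u, v} would violate it.
  sat : ∀ c → c ∈ cs → Sat x c
  sat (eqc u b) c∈cs = let y , ry , yu = local u in trans (sym yu) (satisfies ry c∈cs)
  sat (leq u v) c∈cs with lookup x u in xu | lookup x v in xv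
  ... | false | _    = ≤-minimum _
  ... | true  | true = b≤b
  ... | true  | false =
    let u≢v : u ≢ v
        u≢v = λ { refl → both-values xu xv }
        y₁ , ry₁ , y₁u = local u
        y₀ , ry₀ , y₀v = local v
        y , ry , yu , yv = edge-local (u≢v , leq-implies c∈cs , (y₁ , ry₁ , trans y₁u xu)
                                                              , (y₀ , ry₀ , trans y₀v xv))
    in ⊥-elim (both-values (leq-implies c∈cs ry (trans yu xu)) (trans yv xv))

Block : ℕ → Set
Block n = Σ ℕ λ k → k ≤ⁿ 2 × Vec (Fin n) k

blockVars : Block n → List (Fin n)
blockVars b = toList (proj₂ (proj₂ b))

Agree : Config n → Config n → List (Fin n) → Set
Agree y x vs = ∀ {e} → e ∈ vs → lookup y e ≡ lookup x e

LocallyIn : Relation n → Config n → List (Fin n) → Set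
LocallyIn R x vs = ∃ λ y → R y × Agree y x vs

projection : Relation n → Block n → Factor n
projection R b = record
  { arity   = proj₁ b
  ; arity≤2 = proj₁ (proj₂ b)
  ; vars    = proj₂ (proj₂ b)
  ; rel     = λ w → ∃ λ y → R y × map (lookup y) (proj₂ (proj₂ b)) ≡ w
  }

map-lookup-agree : ∀ {k} (vs : Vec (Fin n) k) {y x} →
                   map (lookup y) vs ≡ map (lookup x) vs → Agree y x (toList vs)
map-lookup-agree (v ∷ vs) eq (here refl) = proj₁ (∷-injective eq)
map-lookup-agree (v ∷ vs) {y} {x} eq (there e∈) = map-lookup-agree vs {y} {x} (proj₂ (∷-injective eq)) e∈

product-of-projections : ∀ {R : Relation n} (bs : List (Block n)) →
  Unique (concatMap blockVars bs) → (∀ i → i ∈ concatMap blockVars bs) →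
  (∀ x → All (LocallyIn R x ∘ blockVars) bs → R x) →
  BasicallyBinary R
product-of-projections {R = R} bs unique cover glue =
  List.map (projection R) bs
  , subst Unique (sym vars≡) unique
  , (λ i → subst (i ∈_) (sym vars≡) (cover i))
  , λ x → mk⇔ (λ rx → All.map⁺ (All.tabulate λ _ → x , rx , refl))
              (λ holds → glue x (All.map (λ (y , ry , eq) → y , ry , map-lookup-agree _ {y} {x} eq)
                                          (All.map⁻ holds)))
  where
  vars≡ : factorVars (List.map (projection R) bs) ≡ concatMap blockVars bs
  vars≡ = cong concat (sym (map-∘ bs))

module MatchingBlocks {n : ℕ} (Adj : Fin n → Fin n → Set) (Adj? : ∀ u v → Dec (Adj u v))
                      (Adj-sym : ∀ {u v} → Adj u v → Adj v u)
                      (Adj-irrefl : ∀ {u v} → Adj u v → u ≢ v)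
                      (Adj-unique : ∀ {i j k} → Adj i j → Adj i k → j ≡ k) where

  partner? : ∀ i → Dec (∃ (Adj i))
  partner? i = any? (Adj? i)

  block : Fin n → Block n
  block i with partner? i
  ... | no _        = 1 , s≤s z≤n , i ∷ []
  ... | yes (j , _) with i <? j
  ...   | yes _ = 2 , ≤-refl , i ∷ j ∷ []
  ...   | no _  = 0 , z≤n , []

  members : Fin n → List (Fin n)
  members = blockVars ∘ block

  Owner : Fin n → Set
  Owner i = ∀ {j} → Adj i j → i < j

  ∈-block : ∀ {i e} → e ∈ members i → (e ≡ i × Owner i) ⊎ (Adj i e × i < e)
  ∈-block {i} e∈ with partner? i
  ∈-block (here refl) | no unmatched = inj₁ (refl , λ a → ⊥-elim (unmatched (_ , a)))
  ∈-block {i} e∈ | yes (j , a) with i <? j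
  ∈-block {i} (here refl) | yes (j , a) | yes i<j =
    inj₁ (refl , λ a' → subst (i <_) (Adj-unique a a') i<j)
  ∈-block (there (here refl)) | yes (j , a) | yes i<j = inj₂ (a , i<j)
  ∈-block () | yes _ | no _

  block-unique : ∀ i → Unique (members i)
  block-unique i with partner? i
  ... | no _        = [] ∷ []
  ... | yes (j , _) with i <? j
  ...   | yes i<j = ((λ i≡j → <-irrefl i≡j i<j) ∷ []) ∷ [] ∷ []
  ...   | no _    = []

  blocks-disjoint : ∀ {i i'} → i ≢ i' → Disjoint (members i) (members i')
  blocks-disjoint i≢i' (e∈i , e∈i') with ∈-block e∈i | ∈-block e∈i'
  ... | inj₁ (refl , _)    | inj₁ (refl , _)     = i≢i' refl
  ... | inj₁ (refl , owns) | inj₂ (a , i'<e)     = <-asym i'<e (owns (Adj-sym a))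
  ... | inj₂ (a , i<e)     | inj₁ (refl , owns)  = <-asym i<e (owns (Adj-sym a))
  ... | inj₂ (a , _)       | inj₂ (a' , _)       = i≢i' (Adj-unique (Adj-sym a) (Adj-sym a'))

  unmatched-owns : ∀ {m} → ¬ ∃ (Adj m) → m ∈ members m
  unmatched-owns {m} unmatched with partner? m
  ... | no _  = here refl
  ... | yes p = ⊥-elim (unmatched p)

  pair-owned : ∀ {u v} → Adj u v → u < v → u ∈ members u × v ∈ members u
  pair-owned {u} a u<v with partner? u
  ... | no unmatched = ⊥-elim (unmatched (_ , a))
  ... | yes (j , a') with Adj-unique a' a
  ...   | refl with u <? j
  ...     | yes _   = here refl , there (here refl)
  ...     | no u≮v = ⊥-elim (u≮v u<v)

  pair-in-block : ∀ {u v} → Adj u v → ∃ λ i → u ∈ members i × v ∈ members i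
  pair-in-block {u} {v} a with <-cmp u v
  ... | tri< u<v _ _ = u , pair-owned a u<v
  ... | tri≈ _ u≡v _ = ⊥-elim (Adj-irrefl a u≡v)
  ... | tri> _ _ v<u = let v∈ , u∈ = pair-owned (Adj-sym a) v<u in v , u∈ , v∈

  in-some-block : ∀ m → ∃ λ i → m ∈ members i
  in-some-block m with partner? m
  ... | no unmatched = m , unmatched-owns unmatched
  ... | yes (_ , a)  = let i , m∈ , _ = pair-in-block a in i , m∈

  blocks : List (Block n)
  blocks = List.map block (allFin n)

  blocks-unique : Unique (concatMap blockVars blocks)
  blocks-unique = concat⁺ (All.map⁺ (All.map⁺ (All.tabulate λ {i} _ → block-unique i)))
                          (AllPairs.map⁺ (AllPairs.map⁺ (AllPairs.map blocks-disjoint (allFin⁺ n))))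

  blocks-cover : ∀ m → m ∈ concatMap blockVars blocks
  blocks-cover m = let i , m∈ = in-some-block m in
    ∈-concat⁺′ m∈ (∈-map⁺ blockVars (∈-map⁺ block (∈-allFin i)))

  module _ {R : Relation n} {x : Config n} (local : All (LocallyIn R x ∘ blockVars) blocks) where

    local-block : ∀ i → LocallyIn R x (members i)
    local-block i = All.lookup (All.map⁻ local) (∈-allFin i)

    local-variable : ∀ e → ∃ λ y → R y × lookup y e ≡ lookup x e
    local-variable e = let i , e∈ = in-some-block e
                           y , ry , agree = local-block i
                       in y , ry , agree e∈

    local-pair : ∀ {u v} → Adj u v →
                 ∃ λ y → R y × lookup y u ≡ lookup x u × lookup y v ≡ lookup x v
    local-pair a = let i , u∈ , v∈ = pair-in-block a
                       y , ry , agree = local-block i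
                   in y , ry , agree u∈ , agree v∈

lemma22 : (n : ℕ) (R : Relation n) → DeltaMatroid R → InIMConj R → BasicallyBinary R
lemma22 n R dm im = product-of-projections blocks blocks-unique blocks-cover glue
  where
  open ImplicationGraph R
  open Decidability (conj-decidable im)
  open Matching dm (conj-closed im _∧_ ∧-monotone ∧-idem) (conj-closed im _∨_ ∨-monotone ∨-idem)
  open MatchingBlocks Adj Adj? Adj-sym Adj-irrefl Adj-unique

  glue : ∀ x → All (LocallyIn R x ∘ blockVars) blocks → R x
  glue x local = conj-glue im x (local-variable {R} {x} local) (local-pair {R} {x} local ∘ inj₁)
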